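{- For any finite coloring of the positive integers $\mathbb{N}$, there exist positive integers $D$ and $X$ such that $DX$ and $DX + D^2$ receive the same color. The same holds for any finite coloring of $\mathbb{Q}$, with $D, X$ nonzero rationals. -}

module Defs where

{-# OPTIONS --safe #-}
-- Van der Waerden's theorem is proved by colour focusing: if every colouring has either a long
-- monochromatic progression or m progressions of distinct colours all pointing at a common next
-- term, then applying van der Waerden to the colouring of long windows produces m + 1 such, and
-- m = k + 1 is impossible. The same focusing with square spokes p + r² = f, whose roots grow by the
-- step d of a progression of identical windows, gives a bound R such that every k-colouring has x and
-- x + y² of one colour with 1 ≤ y ≤ R. Applied to n ↦ c (R!²(n + 1)) with R! = q·y, the choice
-- D = R!·y and X = q·(x + 1) gives DX = R!²(x + 1) and DX + D² = R!²(x + 1 + y²). The rational case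
-- follows by transporting the natural one along ℕ → ℚ.
module Submission where

open import Defs
open import Data.Nat using (ℕ; _+_; _*_; _^_; _>_)
open import Data.Fin using (Fin)
open import Data.Product using (_×_; ∃-syntax)
open import Data.Rational as ℚ using (ℚ; 0ℚ)
open import Relation.Binary.PropositionalEquality using (_≡_; _≢_)

open import Algebra.Bundles using (Ring)
import Algebra.Properties.Semiring.Mult as SemiringMult
open import Data.Empty using (⊥-elim)
import Data.Fin as F
open import Data.Fin using (toℕ; fromℕ<; funToFin; finToFun)
open import Data.Fin.Properties using (finToFun-funToFin; toℕ-fromℕ<; <⇒notInjective; any?)
open import Data.Nat using (zero; suc; _≤_; _∸_; _!; z≤n; s≤s)
open import Data.Nat.Divisibility using (_∣_; divides; ∣-trans; m∣m*n; m≤n⇒m!∣n!)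
open import Data.Nat.Properties
open import Data.Nat.Tactic.RingSolver using (solve-∀)
open import Data.Product using (_,_)
import Data.Rational.Properties as ℚₚ
open import Data.Sum using (_⊎_; inj₁; inj₂; [_,_]′)
open import Function using (_∘_; id)
open import Function.Definitions using (Injective)
open import Relation.Nullary using (yes; no)
open import Relation.Binary.PropositionalEquality using (refl; sym; trans; cong; cong₂; subst; module ≡-Reasoning)

private variable
  A : Set
  k m n J N R W a d f s t u : ℕ

injective-cons : (g : Fin (suc m) → A) → (∀ i → g F.zero ≢ g (F.suc i)) →
                 Injective _≡_ _≡_ (g ∘ F.suc) → Injective _≡_ _≡_ g
injective-cons g new old {F.zero}  {F.zero}  _  = refl
injective-cons g new old {F.zero}  {F.suc j} eq = ⊥-elim (new j eq)
injective-cons g new old {F.suc i} {F.zero}  eq = ⊥-elim (new i (sym eq))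
injective-cons g new old {F.suc i} {F.suc j} eq = cong F.suc (old eq)

window : (ℕ → A) → (n s : ℕ) → Fin (suc n) → A
window c n s i = c (s + toℕ i)

windowColour : (ℕ → Fin k) → (n s : ℕ) → Fin (k ^ suc n)
windowColour c n s = funToFin (window c n s)

windowColour-≡⇒ : (c : ℕ → Fin k) → windowColour c N s ≡ windowColour c N t →
                  u ≤ N → c (s + u) ≡ c (t + u)
windowColour-≡⇒ {N = N} {s} {t} {u} c same u≤N =
  subst (λ v → c (s + v) ≡ c (t + v)) (toℕ-fromℕ< (s≤s u≤N)) (begin
    c (s + toℕ i)                   ≡⟨ finToFun-funToFin (window c N s) i ⟨
    finToFun (windowColour c N s) i ≡⟨ cong (λ w → finToFun w i) same ⟩
    finToFun (windowColour c N t) i ≡⟨ finToFun-funToFin (window c N t) i ⟩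
    c (t + toℕ i)                   ∎)
  where
  open ≡-Reasoning
  i = fromℕ< (s≤s u≤N)

IsMonoAP : (ℕ → A) → (J a d : ℕ) → Set
IsMonoAP c J a d = ∀ j → j ≤ J → c (a + j * d) ≡ c a

IdenticalBlocks : (ℕ → A) → (N J a d : ℕ) → Set
IdenticalBlocks c N J a d = ∀ j → j ≤ J → ∀ u → u ≤ N → c (a + j * d + u) ≡ c (a + u)

monoWindows⇒identicalBlocks : (c : ℕ → Fin k) → IsMonoAP (windowColour c N) J a d →
                              IdenticalBlocks c N J a d
monoWindows⇒identicalBlocks c mono j j≤J u u≤N = windowColour-≡⇒ c (mono j j≤J) u≤N

record MonochromaticAP (c : ℕ → A) (J W : ℕ) : Set where
  constructor monoAP
  field
    start step : ℕ
    step≥1     : 1 ≤ step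
    within     : start + suc J * step ≤ W
    mono       : IsMonoAP c J start step

  start≤W : start ≤ W
  start≤W = ≤-trans (m≤m+n start _) within

VanDerWaerden : (k J : ℕ) → Set
VanDerWaerden k J = ∃[ W ] ((c : ℕ → Fin k) → MonochromaticAP c J W)

shiftAP : (c : ℕ → A) → a ≤ W → MonochromaticAP (c ∘ (a +_)) J N → MonochromaticAP c J (W + N)
shiftAP {a = a} {W} {J} {N} c a≤W (monoAP s e e≥1 within mono) =
  monoAP (a + s) e e≥1
    (subst (_≤ W + N) (sym (+-assoc a s (suc J * e))) (+-mono-≤ a≤W within))
    (λ j j≤J → trans (cong c (+-assoc a s (j * e))) (mono j j≤J))

weakenAP : N ≤ W → (c : ℕ → A) → MonochromaticAP c J N → MonochromaticAP c J W
weakenAP N≤W c (monoAP s e e≥1 within mono) = monoAP s e e≥1 (≤-trans within N≤W) mono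

-- Van der Waerden's theorem

record Spoke (c : ℕ → A) (J f : ℕ) : Set where
  field
    start step : ℕ
    step≥1     : 1 ≤ step
    reaches    : start + suc J * step ≡ f
    mono       : IsMonoAP c J start step

  term≤focus : ∀ j → j ≤ suc J → start + j * step ≤ f
  term≤focus j j≤1+J = subst (start + j * step ≤_) reaches (+-monoʳ-≤ start (*-monoˡ-≤ step j≤1+J))

  step≤focus : step ≤ f
  step≤focus = subst (step ≤_) reaches (≤-trans (m≤m+n step (J * step)) (m≤n+m _ start))

record Focused (c : ℕ → A) (J N m : ℕ) : Set where
  field
    focus           : ℕ
    focus≤N         : focus ≤ N
    spoke           : Fin m → Spoke c J focus
    distinctColours : Injective _≡_ _≡_ (c ∘ Spoke.start ∘ spoke)

spoke⇒monoAP : (c : ℕ → A) → (σ : Spoke c J f) → f ≤ N → c f ≡ c (Spoke.start σ) →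
               MonochromaticAP c (suc J) (N + N)
spoke⇒monoAP {J = J} {f} {N} c σ f≤N same =
  monoAP start step step≥1 within mono′
  where
  open Spoke σ
  within : start + suc (suc J) * step ≤ N + N
  within = subst (_≤ N + N) (sym (trans (shuffle start step (suc J * step)) (cong (_+ step) reaches)))
             (+-mono-≤ f≤N (≤-trans step≤focus f≤N))
    where
    shuffle : ∀ x y z → x + (y + z) ≡ x + z + y
    shuffle = solve-∀
  mono′ : IsMonoAP c (suc J) start step
  mono′ j j≤1+J with m≤n⇒m<n∨m≡n j≤1+J
  ... | inj₁ (s≤s j≤J) = mono j j≤J
  ... | inj₂ refl      = trans (cong c reaches) same

blockSpoke : (c : ℕ → A) → IdenticalBlocks c N J a d → 1 ≤ d → f ≤ N →
             Spoke c J (a + suc J * d + f)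
blockSpoke {J = J} {a} {d} {f} c blocks d≥1 f≤N = record
  { start   = a + f
  ; step    = d
  ; step≥1  = d≥1
  ; reaches = swap a f (suc J * d)
  ; mono    = λ j j≤J → trans (cong c (swap a f (j * d))) (blocks j j≤J f f≤N)
  }
  where
  swap : ∀ x y z → x + y + z ≡ x + z + y
  swap = solve-∀

-- Each block a + j·d + [0, N] repeats the colours of the first, so a spoke inside the first
-- block, with its step increased by d, stays monochromatic and ends d·(J + 1) further on.
stretchSpoke : (c : ℕ → A) → IdenticalBlocks c N J a d → f ≤ N →
               Spoke (c ∘ (a +_)) J f → Spoke c J (a + suc J * d + f)
stretchSpoke {N = N} {J} {a} {d} {f} c blocks f≤N σ = record
  { start   = a + start
  ; step    = step + d
  ; step≥1  = ≤-trans step≥1 (m≤m+n step d)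
  ; reaches = trans (regroup a start (suc J) step d) (cong (a + suc J * d +_) reaches)
  ; mono    = mono′
  }
  where
  open Spoke σ
  regroup : ∀ x s j e δ → x + s + j * (e + δ) ≡ x + j * δ + (s + j * e)
  regroup = solve-∀
  mono′ : IsMonoAP c J (a + start) (step + d)
  mono′ j j≤J = begin
    c (a + start + j * (step + d))   ≡⟨ cong c (regroup a start j step d) ⟩
    c (a + j * d + (start + j * step)) ≡⟨ blocks j j≤J _ (≤-trans (term≤focus j (m≤n⇒m≤1+n j≤J)) f≤N) ⟩
    c (a + (start + j * step))       ≡⟨ mono j j≤J ⟩
    c (a + start)                    ∎
    where open ≡-Reasoning

extendFocused : (c : ℕ → Fin k) → IdenticalBlocks c N J a d → 1 ≤ d → a + suc J * d ≤ W →
                (Φ : Focused (c ∘ (a +_)) J N m) →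
                (∀ i → c (a + Focused.focus Φ) ≢ c (a + Spoke.start (Focused.spoke Φ i))) →
                Focused c J (W + (N + N)) (suc m)
extendFocused {N = N} {J} {a} {d} {W} c blocks d≥1 within Φ new = record
  { focus           = a + suc J * d + focus
  ; focus≤N         = +-mono-≤ within (≤-trans focus≤N (m≤m+n N N))
  ; spoke           = spoke′
  ; distinctColours = injective-cons (c ∘ Spoke.start ∘ spoke′) new distinctColours
  }
  where
  open Focused Φ
  spoke′ : Fin (suc _) → Spoke c J (a + suc J * d + focus)
  spoke′ F.zero    = blockSpoke c blocks d≥1 focus≤N
  spoke′ (F.suc i) = stretchSpoke c blocks focus≤N (spoke i)

focusing : (J : ℕ) → (∀ k → VanDerWaerden k J) →
           ∀ k m → ∃[ N ] ((c : ℕ → Fin k) → MonochromaticAP c (suc J) N ⊎ Focused c J N m)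
focusing J vdw k zero = 0 , λ c → inj₂ (record
  { focus = 0 ; focus≤N = z≤n ; spoke = λ () ; distinctColours = λ { {()} } })
focusing J vdw k (suc m) with focusing J vdw k m
... | N , focusedOrAP with vdw (k ^ suc N)
... | W , windowAP = W + (N + N) , step
  where
  step : (c : ℕ → Fin k) → MonochromaticAP c (suc J) (W + (N + N)) ⊎ Focused c J (W + (N + N)) (suc m)
  step c with windowAP (windowColour c N)
  ... | ap@(monoAP a d d≥1 within mono) with focusedOrAP (c ∘ (a +_))
  ... | inj₁ ap′ = inj₁ (shiftAP c (MonochromaticAP.start≤W ap) (weakenAP (m≤m+n N N) _ ap′))
  ... | inj₂ Φ with any? (λ i → c (a + Focused.focus Φ) F.≟ c (a + Spoke.start (Focused.spoke Φ i)))
  ...   | yes (i , same) = inj₁ (shiftAP c (MonochromaticAP.start≤W ap)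
                             (spoke⇒monoAP (c ∘ (a +_)) (Focused.spoke Φ i) (Focused.focus≤N Φ) same))
  ...   | no ¬same = inj₂ (extendFocused c (monoWindows⇒identicalBlocks c mono) d≥1 within Φ
                             (λ i same → ¬same (i , same)))

vanDerWaerden : ∀ k J → VanDerWaerden k J
vanDerWaerden k zero = 1 , λ c → monoAP 0 1 ≤-refl ≤-refl (λ { zero z≤n → refl })
vanDerWaerden k (suc J) with focusing J (λ k′ → vanDerWaerden k′ J) k (suc k)
... | N , focusedOrAP = N , λ c → [ id , tooManyColours c ]′ (focusedOrAP c)
  where
  tooManyColours : (c : ℕ → Fin k) → Focused c J N (suc k) → MonochromaticAP c (suc J) N
  tooManyColours c Φ = ⊥-elim (<⇒notInjective (n<1+n k) (Focused.distinctColours Φ))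

-- Monochromatic square differences

SquareDifference : (ℕ → A) → ℕ → Set
SquareDifference c R = ∃[ x ] ∃[ y ] (1 ≤ y × y ≤ R × c x ≡ c (x + y * y))

record SquareSpoke (R f : ℕ) : Set where
  field
    start root : ℕ
    root≥1     : 1 ≤ root
    root≤R     : root ≤ R
    reaches    : start + root * root ≡ f

  start≤focus : start ≤ f
  start≤focus = subst (start ≤_) reaches (m≤m+n start _)

record SquareFocused (c : ℕ → A) (N R m : ℕ) : Set where
  field
    focus           : ℕ
    focus≤N         : focus ≤ N
    spoke           : Fin m → SquareSpoke R focus
    distinctColours : Injective _≡_ _≡_ (c ∘ SquareSpoke.start ∘ spoke)

shiftSquareDifference : (c : ℕ → A) → R ≤ W → SquareDifference (c ∘ (a +_)) R → SquareDifference c W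
shiftSquareDifference {a = a} c R≤W (x , y , y≥1 , y≤R , same) =
  a + x , y , y≥1 , ≤-trans y≤R R≤W , trans same (cong c (sym (+-assoc a x (y * y))))

squareSpoke⇒squareDifference : (c : ℕ → A) → (σ : SquareSpoke R f) → c f ≡ c (SquareSpoke.start σ) →
                               SquareDifference c R
squareSpoke⇒squareDifference c σ same =
  start , root , root≥1 , root≤R , trans (sym same) (cong c (sym reaches))
  where open SquareSpoke σ

-- Moving the start back by 2·r·d and enlarging the root r by d adds exactly d² at the far end,
-- since (r + d)² = r² + 2·r·d + d².
stretchSquareSpoke : ∀ a → d ≤ W → SquareSpoke R f → SquareSpoke (R + W) (a + 2 * R * d + f + d * d)
stretchSquareSpoke {d} {W} {R} {f} a d≤W σ = record
  { start   = a + (2 * R ∸ 2 * root) * d + start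
  ; root    = root + d
  ; root≥1  = ≤-trans root≥1 (m≤m+n root d)
  ; root≤R  = +-mono-≤ root≤R d≤W
  ; reaches = trans (expand a (2 * R ∸ 2 * root) d start root)
                (cong₂ (λ j g → a + j * d + g + d * d) (m∸n+n≡m (*-monoʳ-≤ 2 root≤R)) reaches)
  }
  where
  open SquareSpoke σ
  expand : ∀ x j e p r → x + j * e + p + (r + e) * (r + e) ≡ x + (j + 2 * r) * e + (p + r * r) + e * e
  expand = solve-∀

stretchSquareSpoke-colour : (c : ℕ → A) → IdenticalBlocks c N (2 * R) a d → f ≤ N → (d≤W : d ≤ W) →
                            (σ : SquareSpoke R f) →
                            c (SquareSpoke.start (stretchSquareSpoke a d≤W σ)) ≡
                            c (a + 2 * R * d + SquareSpoke.start σ)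
stretchSquareSpoke-colour {R = R} c blocks f≤N _ σ =
  trans (blocks (2 * R ∸ 2 * root) (m∸n≤m (2 * R) (2 * root)) start start≤N)
        (sym (blocks (2 * R) ≤-refl start start≤N))
  where
  open SquareSpoke σ
  start≤N = ≤-trans start≤focus f≤N

extendSquareFocused : (c : ℕ → Fin k) → IdenticalBlocks c N (2 * R) a d → 1 ≤ d →
                      a + suc (2 * R) * d ≤ W →
                      (Φ : SquareFocused (c ∘ (a + 2 * R * d +_)) N R m) →
                      (∀ i → c (a + 2 * R * d + SquareFocused.focus Φ) ≢
                             c (a + 2 * R * d + SquareSpoke.start (SquareFocused.spoke Φ i))) →
                      SquareFocused c (W + N + W * W) (R + W) (suc m)
extendSquareFocused {N = N} {R} {a} {d} {W} c blocks d≥1 within Φ new = record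
  { focus           = b + focus + d * d
  ; focus≤N         = +-mono-≤ (+-mono-≤ b≤W focus≤N) (*-mono-≤ d≤W d≤W)
  ; spoke           = spoke′
  ; distinctColours = injective-cons (c ∘ SquareSpoke.start ∘ spoke′)
      (λ i same → new i (trans same (colour i)))
      (λ {i} {j} same → distinctColours (trans (sym (colour i)) (trans same (colour j))))
  }
  where
  open SquareFocused Φ
  b = a + 2 * R * d
  d≤W : d ≤ W
  d≤W = ≤-trans (≤-trans (m≤m+n d (2 * R * d)) (m≤n+m _ a)) within
  b≤W : b ≤ W
  b≤W = ≤-trans (+-monoʳ-≤ a (m≤n+m (2 * R * d) d)) within
  spoke′ : Fin (suc _) → SquareSpoke (R + W) (b + focus + d * d)
  spoke′ F.zero    = record { start = b + focus ; root = d ; root≥1 = d≥1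
                            ; root≤R = ≤-trans d≤W (m≤n+m W R) ; reaches = refl }
  spoke′ (F.suc i) = stretchSquareSpoke a d≤W (spoke i)
  colour : ∀ i → c (SquareSpoke.start (spoke′ (F.suc i))) ≡ c (b + SquareSpoke.start (spoke i))
  colour i = stretchSquareSpoke-colour c blocks focus≤N d≤W (spoke i)

squareFocusing : ∀ k m → ∃[ N ] ∃[ R ] ((c : ℕ → Fin k) → SquareDifference c R ⊎ SquareFocused c N R m)
squareFocusing k zero = 0 , 0 , λ c → inj₂ (record
  { focus = 0 ; focus≤N = z≤n ; spoke = λ () ; distinctColours = λ { {()} } })
squareFocusing k (suc m) with squareFocusing k m
... | N , R , focusedOrDifference with vanDerWaerden (k ^ suc N) (2 * R)
... | W , windowAP = W + N + W * W , R + W , step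
  where
  step : (c : ℕ → Fin k) → SquareDifference c (R + W) ⊎ SquareFocused c (W + N + W * W) (R + W) (suc m)
  step c with windowAP (windowColour c N)
  ... | monoAP a d d≥1 within mono with focusedOrDifference (c ∘ (a + 2 * R * d +_))
  ... | inj₁ δ = inj₁ (shiftSquareDifference c (m≤m+n R W) δ)
  ... | inj₂ Φ with any? (λ i → c (a + 2 * R * d + SquareFocused.focus Φ) F.≟
                                c (a + 2 * R * d + SquareSpoke.start (SquareFocused.spoke Φ i)))
  ...   | yes (i , same) = inj₁ (shiftSquareDifference {a = a + 2 * R * d} c (m≤m+n R W)
                             (squareSpoke⇒squareDifference (c ∘ (a + 2 * R * d +_)) (SquareFocused.spoke Φ i) same))
  ...   | no ¬same = inj₂ (extendSquareFocused c (monoWindows⇒identicalBlocks c mono) d≥1 within Φ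
                             (λ i same → ¬same (i , same)))

squareDifferences : ∀ k → ∃[ R ] ((c : ℕ → Fin k) → SquareDifference c R)
squareDifferences k with squareFocusing k (suc k)
... | N , R , focusedOrDifference = R , λ c → [ id , tooManyColours c ]′ (focusedOrDifference c)
  where
  tooManyColours : (c : ℕ → Fin k) → SquareFocused c N R (suc k) → SquareDifference c R
  tooManyColours c Φ = ⊥-elim (<⇒notInjective (n<1+n k) (SquareFocused.distinctColours Φ))

n∣m! : 1 ≤ n → n ≤ m → n ∣ m !
n∣m! {suc n} _ n≤m = ∣-trans (m∣m*n (n !)) (m≤n⇒m!∣n! n≤m)

DX≡M²[x+1] : ∀ {M} q y x → M ≡ q * y → M * y * (q * suc x) ≡ M * M * suc x
DX≡M²[x+1] q y x refl = identity q y x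
  where
  identity : ∀ q y x → q * y * y * (q * suc x) ≡ q * y * (q * y) * suc x
  identity = solve-∀

DX+D²≡M²[x+1+y²] : ∀ {M} q y x → M ≡ q * y → M * y * (q * suc x) + (M * y) ^ 2 ≡ M * M * suc (x + y * y)
DX+D²≡M²[x+1+y²] q y x refl = trans (cong (q * y * y * (q * suc x) +_) (cong (q * y * y *_) (*-identityʳ _)))
                                    (identity q y x)
  where
  identity : ∀ q y x → q * y * y * (q * suc x) + q * y * y * (q * y * y) ≡ q * y * (q * y) * suc (x + y * y)
  identity = solve-∀

sameColourℕ : (k : ℕ) (c : ℕ → Fin k) → ∃[ D ] ∃[ X ] (D > 0 × X > 0 × c (D * X) ≡ c (D * X + D ^ 2))
sameColourℕ k c with squareDifferences k
... | R , differences with differences (λ n → c (R ! * R ! * suc n))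
... | x , y , y≥1 , y≤R , same with n∣m! y≥1 y≤R
... | divides zero R!≡0 = ⊥-elim (<⇒≱ (1≤n! R) (≤-reflexive R!≡0))
... | divides q@(suc _) R!≡qy =
  R ! * y , q * suc x , *-mono-≤ (1≤n! R) y≥1 , s≤s z≤n ,
  trans (cong c (DX≡M²[x+1] q y x R!≡qy)) (trans same (cong c (sym (DX+D²≡M²[x+1+y²] q y x R!≡qy))))

open SemiringMult (Ring.semiring ℚₚ.+-*-ring) using (×-homo-+; ×1-homo-*) renaming (_×_ to _×ₙ_)

fromℕ : ℕ → ℚ
fromℕ n = n ×ₙ ℚ.1ℚ

fromℕ-nonNegative : ∀ n → ℚ.NonNegative (fromℕ n)
fromℕ-nonNegative zero    = _
fromℕ-nonNegative (suc n) = ℚₚ.nonNeg+nonNeg⇒nonNeg ℚ.1ℚ (fromℕ n) {{fromℕ-nonNegative n}}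

fromℕ-≢0 : n > 0 → fromℕ n ≢ 0ℚ
fromℕ-≢0 {suc n} _ eq = ℚₚ.<⇒≢ (ℚₚ.positive⁻¹ (fromℕ (suc n)) {{positive}}) (sym eq)
  where
  positive : ℚ.Positive (fromℕ (suc n))
  positive = ℚₚ.pos+nonNeg⇒pos ℚ.1ℚ (fromℕ n) {{fromℕ-nonNegative n}}

sameColourℚ : (k : ℕ) (c : ℚ → Fin k) →
              ∃[ D ] ∃[ X ] (D ≢ 0ℚ × X ≢ 0ℚ × c (D ℚ.* X) ≡ c (D ℚ.* X ℚ.+ D ℚ.* D))
sameColourℚ k c with sameColourℕ k (c ∘ fromℕ)
... | D , X , D>0 , X>0 , same = fromℕ D , fromℕ X , fromℕ-≢0 D>0 , fromℕ-≢0 X>0 , (begin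
  c (fromℕ D ℚ.* fromℕ X)                           ≡⟨ cong c (×1-homo-* D X) ⟨
  c (fromℕ (D * X))                                 ≡⟨ same ⟩
  c (fromℕ (D * X + D ^ 2))                         ≡⟨ cong c (×-homo-+ ℚ.1ℚ (D * X) (D ^ 2)) ⟩
  c (fromℕ (D * X) ℚ.+ fromℕ (D * (D * 1)))         ≡⟨ cong c (cong₂ ℚ._+_ (×1-homo-* D X)
                                                         (cong (fromℕ ∘ (D *_)) (*-identityʳ D))) ⟩
  c (fromℕ D ℚ.* fromℕ X ℚ.+ fromℕ (D * D))         ≡⟨ cong (λ z → c (fromℕ D ℚ.* fromℕ X ℚ.+ z)) (×1-homo-* D D) ⟩
  c (fromℕ D ℚ.* fromℕ X ℚ.+ fromℕ D ℚ.* fromℕ D)   ∎)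
  where open ≡-Reasoning

mainTheorem4 : ((k : ℕ) (c : ℕ → Fin k) → ∃[ D ] ∃[ X ] (D > 0 × X > 0 × c (D * X) ≡ c (D * X + D ^ 2)))
    × ((k : ℕ) (c : ℚ → Fin k) → ∃[ D ] ∃[ X ] (D ≢ 0ℚ × X ≢ 0ℚ × c (D ℚ.* X) ≡ c (D ℚ.* X ℚ.+ D ℚ.* D)))
mainTheorem4 = sameColourℕ , sameColourℚ
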